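{- Let $\mathbf S=(S,\leq,*,1)$ be a skew Hilbert algebra and $\Theta$ an algebraic congruence on $\mathbf S$ such that every class of $\Theta$, ordered by the restriction of $\leq$, satisfies the Ascending Chain Condition. Then $\Theta$ is a congruence on $\mathbf S$ (i.e. $\Theta$ is min-stable).
   Context: For a poset and a subset $A$, $L(A)$, $U(A)$ are the sets of lower and upper bounds; $L(U(x,y),z)=L(U(\{x,y\})\cup\{z\})$. A skew Hilbert algebra is a poset $(S,\leq,*,1)$ with binary operation $*$ and constant $1$ such that for all $x,y,z$: (S1) $x\leq y$ iff $x*y=1$; (S2) if $y*x=1$ then $x*((x*y)*y)=1$; (S3) if $x*y=1$ then $(y*z)*(x*z)=1$; (S4) $L(U(x,y),x*y)=L(y)$. An algebraic congruence on $\mathbf S$ is a congruence of the groupoid $(S,*)$. A relation $\rho$ is min-stable if $(a,b),(c,d)\in\rho$ with $a,c$ comparable and $b,d$ comparable imply $(\min(a,c),\min(b,d))\in\rho$; a congruence on $\mathbf S$ is a min-stable algebraic congruence. -}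

module Defs where

open import Level using (Level; _⊔_; suc)
open import Data.Nat using (ℕ) renaming (_≤_ to _≤ℕ_)
open import Data.Product using (_×_; Σ; ∃)
open import Data.Sum using (_⊎_)
open import Relation.Binary.PropositionalEquality using (_≡_)
open import Relation.Binary.Structures using (IsPartialOrder; IsEquivalence)

record SkewHilbertAlgebra (c ℓ : Level) : Set (Level.suc (c ⊔ ℓ)) where
  infix 4 _≤_
  infixr 6 _*_
  field
    S     : Set c
    _≤_   : S → S → Set ℓ
    isPartialOrder : IsPartialOrder _≡_ _≤_
    _*_   : S → S → S
    𝟏     : S
    S1→ : ∀ {x y} → x ≤ y → x * y ≡ 𝟏
    S1← : ∀ {x y} → x * y ≡ 𝟏 → x ≤ y
    S2  : ∀ {x y} → y * x ≡ 𝟏 → x * ((x * y) * y) ≡ 𝟏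
    S3  : ∀ {x y z} → x * y ≡ 𝟏 → (y * z) * (x * z) ≡ 𝟏
    -- (S4) L(U(x,y), x * y) = L(y), stated elementwise:
    -- w ∈ L(U({x,y}) ∪ {x*y})  iff  w ≤ y
    S4→ : ∀ {x y w} → (∀ u → x ≤ u → y ≤ u → w ≤ u) → w ≤ x * y → w ≤ y
    S4← : ∀ {x y w} → w ≤ y → (∀ u → x ≤ u → y ≤ u → w ≤ u) × (w ≤ x * y)

module _ {c ℓ : Level} (𝐒 : SkewHilbertAlgebra c ℓ) where
  open SkewHilbertAlgebra 𝐒

  record IsAlgebraicCongruence {r : Level} (Θ : S → S → Set r) : Set (c ⊔ r) where
    field
      isEquivalence : IsEquivalence Θ
      *-cong : ∀ {a b c d} → Θ a b → Θ c d → Θ (a * c) (b * d)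

  ClassesACC : {r : Level} → (S → S → Set r) → Set (c ⊔ ℓ ⊔ r)
  ClassesACC Θ = ∀ (a : S) (f : ℕ → S) →
    (∀ n → Θ a (f n)) →
    (∀ n → f n ≤ f (ℕ.suc n)) →
    ∃ λ m → ∀ n → m ≤ℕ n → f n ≡ f m

  IsMinOf : S → S → S → Set (c ⊔ ℓ)
  IsMinOf m a c = (m ≡ a × a ≤ c) ⊎ (m ≡ c × c ≤ a)

  MinStable : {r : Level} → (S → S → Set r) → Set (c ⊔ ℓ ⊔ r)
  MinStable Θ = ∀ {a b c d m n} → Θ a b → Θ c d →
    IsMinOf m a c → IsMinOf n b d → Θ m n

  IsCongruence : {r : Level} → (S → S → Set r) → Set (c ⊔ ℓ ⊔ r)
  IsCongruence Θ = IsAlgebraicCongruence Θ × MinStable Θ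

-- If (a,b),(c,d) ∈ Θ with a ≤ c but d ≤ b, then c * a Θ d * b = 1, and this lets us
-- push a and c upwards inside their own classes: p ↦ (q * p) * p and q ↦ (p * q) * q
-- stay in the classes of a and c (since x * y Θ 1 gives (x * y) * y Θ 1 * y = y) and,
-- by (S2), produce an interleaved chain p₀ ≤ q₀ ≤ p₁ ≤ q₁ ≤ ⋯. ACC on the class of a
-- stops it, which squeezes some pₘ = qₘ, so a Θ c.
module Submission where

open import Defs
open import Level using (Level)
open import Data.Nat using (ℕ; zero; suc)
open import Data.Nat.Properties using (n≤1+n)
open import Data.Product using (_×_; _,_; proj₁; proj₂; ∃)
open import Data.Sum using (inj₁; inj₂)
open import Relation.Binary.PropositionalEquality using (_≡_; refl; sym; subst)
open import Relation.Binary.Structures using (IsPartialOrder; IsEquivalence)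

module SkewHilbertProperties {c ℓ : Level} (𝐒 : SkewHilbertAlgebra c ℓ) where
  open SkewHilbertAlgebra 𝐒
  open IsPartialOrder isPartialOrder using (antisym)
    renaming (refl to ≤-refl; trans to ≤-trans)

  x*x≡𝟏 : ∀ x → x * x ≡ 𝟏
  x*x≡𝟏 x = S1→ ≤-refl

  x≤𝟏 : ∀ x → x ≤ 𝟏
  x≤𝟏 x = subst (x ≤_) (x*x≡𝟏 x) (proj₂ (S4← {x} {x} ≤-refl))

  𝟏*x≡x : ∀ x → 𝟏 * x ≡ x
  𝟏*x≡x x = antisym (S4→ {𝟏} (λ u 𝟏≤u _ → ≤-trans (x≤𝟏 _) 𝟏≤u) ≤-refl)
                    (proj₂ (S4← {𝟏} ≤-refl))

  y≤x⇒x≤[x*y]*y : ∀ {x y} → y ≤ x → x ≤ (x * y) * y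
  y≤x⇒x≤[x*y]*y y≤x = S1← (S2 (S1→ y≤x))

module AlgebraicCongruenceProperties {c ℓ r : Level} (𝐒 : SkewHilbertAlgebra c ℓ)
    {Θ : SkewHilbertAlgebra.S 𝐒 → SkewHilbertAlgebra.S 𝐒 → Set r}
    (isAlgCong : IsAlgebraicCongruence 𝐒 Θ) where
  open SkewHilbertAlgebra 𝐒
  open SkewHilbertProperties 𝐒
  open IsAlgebraicCongruence isAlgCong
  open IsEquivalence isEquivalence renaming (refl to Θ-refl; sym to Θ-sym; trans to Θ-trans)

  ≡⇒Θ : ∀ {x y} → x ≡ y → Θ x y
  ≡⇒Θ refl = Θ-refl

  ≤⇒Θ-*𝟏 : ∀ {x x′ y y′} → Θ x x′ → Θ y y′ → x′ ≤ y′ → Θ (x * y) 𝟏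
  ≤⇒Θ-*𝟏 xx′ yy′ x′≤y′ = Θ-trans (*-cong xx′ yy′) (≡⇒Θ (S1→ x′≤y′))

  Θ-[x*y]*y : ∀ {x y} → Θ (x * y) 𝟏 → Θ y ((x * y) * y)
  Θ-[x*y]*y {x} {y} xy𝟏 = Θ-trans (≡⇒Θ (sym (𝟏*x≡x y))) (*-cong (Θ-sym xy𝟏) Θ-refl)

module ACCProperties {c ℓ r : Level} (𝐒 : SkewHilbertAlgebra c ℓ)
    (Θ : SkewHilbertAlgebra.S 𝐒 → SkewHilbertAlgebra.S 𝐒 → Set r)
    (acc : ClassesACC 𝐒 Θ) where
  open SkewHilbertAlgebra 𝐒
  open IsPartialOrder isPartialOrder using (antisym) renaming (trans to ≤-trans)

  interleaved-chains-meet : ∀ a (p q : ℕ → S) → (∀ n → Θ a (p n)) →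
    (∀ n → p n ≤ q n) → (∀ n → q n ≤ p (suc n)) → ∃ λ m → p m ≡ q m
  interleaved-chains-meet a p q ap p≤q q≤p′ =
    let m , stable = acc a p ap (λ n → ≤-trans (p≤q n) (q≤p′ n))
    in m , antisym (p≤q m) (subst (q m ≤_) (stable (suc m) (n≤1+n m)) (q≤p′ m))

module _ {c ℓ r : Level} (𝐒 : SkewHilbertAlgebra c ℓ)
    {Θ : SkewHilbertAlgebra.S 𝐒 → SkewHilbertAlgebra.S 𝐒 → Set r}
    (isAlgCong : IsAlgebraicCongruence 𝐒 Θ) (acc : ClassesACC 𝐒 Θ) where
  open SkewHilbertAlgebra 𝐒
  open SkewHilbertProperties 𝐒
  open AlgebraicCongruenceProperties 𝐒 isAlgCong
  open ACCProperties 𝐒 Θ acc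
  open IsAlgebraicCongruence isAlgCong
  open IsEquivalence isEquivalence renaming (refl to Θ-refl; sym to Θ-sym; trans to Θ-trans)

  crossed-pairs-related : ∀ {a b c d} → Θ a b → Θ c d → a ≤ c → d ≤ b → Θ a c
  crossed-pairs-related {a} {b} {c} {d} ab cd a≤c d≤b =
    let m , pₘ≡qₘ = interleaved-chains-meet a p q (λ n → proj₁ (invariant n))
                      (λ n → proj₂ (proj₂ (invariant n))) q≤p′
    in Θ-trans (proj₁ (invariant m)) (Θ-trans (≡⇒Θ pₘ≡qₘ) (Θ-sym (proj₁ (proj₂ (invariant m)))))
    where
    p q : ℕ → S
    p zero    = a
    p (suc n) = (q n * p n) * p n
    q zero    = c
    q (suc n) = (p (suc n) * q n) * q n

    invariant : ∀ n → Θ a (p n) × Θ c (q n) × p n ≤ q n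
    invariant zero = Θ-refl , Θ-refl , a≤c
    invariant (suc n) with invariant n
    ... | ap , cq , p≤q = ap′ , cq′ , y≤x⇒x≤[x*y]*y (y≤x⇒x≤[x*y]*y p≤q)
      where
      ap′ : Θ a (p (suc n))
      ap′ = Θ-trans ap (Θ-[x*y]*y (≤⇒Θ-*𝟏 (Θ-trans (Θ-sym cq) cd) (Θ-trans (Θ-sym ap) ab) d≤b))
      cq′ : Θ c (q (suc n))
      cq′ = Θ-trans cq (Θ-[x*y]*y (≤⇒Θ-*𝟏 (Θ-sym ap′) (Θ-sym cq) a≤c))

    q≤p′ : ∀ n → q n ≤ p (suc n)
    q≤p′ n = y≤x⇒x≤[x*y]*y (proj₂ (proj₂ (invariant n)))

  minStable : MinStable 𝐒 Θ
  minStable ab cd (inj₁ (refl , _))   (inj₁ (refl , _))   = ab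
  minStable ab cd (inj₁ (refl , a≤c)) (inj₂ (refl , d≤b)) = Θ-trans (crossed-pairs-related ab cd a≤c d≤b) cd
  minStable ab cd (inj₂ (refl , c≤a)) (inj₁ (refl , b≤d)) = Θ-trans (crossed-pairs-related cd ab c≤a b≤d) ab
  minStable ab cd (inj₂ (refl , _))   (inj₂ (refl , _))   = cd

mainTheorem13 : {c ℓ r : Level} (𝐒 : SkewHilbertAlgebra c ℓ)
    (Θ : SkewHilbertAlgebra.S 𝐒 → SkewHilbertAlgebra.S 𝐒 → Set r) →
    IsAlgebraicCongruence 𝐒 Θ → ClassesACC 𝐒 Θ → IsCongruence 𝐒 Θ
mainTheorem13 𝐒 Θ isAlgCong acc = isAlgCong , minStable 𝐒 isAlgCong acc
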